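{- Let $G$ be a graph with $n$ vertices and $m$ edges, and $S(G)$ its subdivision graph. Then $P_2(m^3M_1^2)(S(G))=64m^5+(16M_1^2-96)m^4+(-8M_1^3-112M_1^2+48)m^3+(-12(M_1^2)^2+72M_1^3+120M_1^2+12M_1^4+48M_2^1-8)m^2+(12(M_1^2)^2+(6M_1^3-44)M_1^2-54M_1^3-48M_2^1-34M_1^4-6M_1^5-12\alpha_{1,2})m-3(M_1^2)^2+(-3M_1^3-M_1^4+5)M_1^2+10M_1^3+12M_2^1+12M_1^4+6M_1^5+M_1^6+6\alpha_{1,2}+2\alpha_{1,3}$, where the invariants on the right are evaluated at $G$.
   Context: $S(G)$ is obtained from $G$ by inserting a new vertex on each edge. $M_1^\alpha=\sum_v\deg(v)^\alpha$; $M_2^1=\sum_{uv\in E}\deg(u)\deg(v)$; $\alpha_{\lambda,\xi}=\sum_{uv\in E}[\deg(u)^\lambda\deg(v)^\xi+\deg(u)^\xi\deg(v)^\lambda]$. $m^3M_1^2$ denotes the invariant $H\mapsto m(H)^3M_1^2(H)$. For a graph invariant $f$, $P_2f(H)=\sum_{uv\in E(H)}f(H-\{u,v\})$, where $H-\{u,v\}$ is obtained by deleting vertices $u,v$ and all incident edges. -}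

module Defs where

open import Data.Nat using (ℕ; zero; suc; _+_; _*_; _^_; _<_; _≡ᵇ_)
open import Data.Bool using (Bool; true; false; _∨_; not)
open import Data.Nat.ListAction using (sum)
open import Data.List using (List; []; _∷_; length; map; filterᵇ; _++_; upTo; zipWith; concat)
open import Data.Product using (_×_; _,_; proj₁; proj₂)
open import Data.List.Relation.Unary.All using (All)
open import Data.List.Relation.Unary.Unique.Propositional using (Unique)
open import Data.List.Membership.Propositional using (_∈_)

record Graph : Set where
  constructor graph
  field
    V : List ℕ
    E : List (ℕ × ℕ)
open Graph public

-- A (finite, simple) graph: distinct vertices, distinct edges, each edge {a,b}
-- stored once as (a , b) with a < b (so no loops, no multi-edges), endpoints in V.
IsSimpleGraph : Graph → Set
IsSimpleGraph G =
  Unique (V G) × Unique (E G) ×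
  All (λ e → (proj₁ e < proj₂ e) × (proj₁ e ∈ V G) × (proj₂ e ∈ V G)) (E G)

touches : ℕ × ℕ → ℕ → Bool
touches (a , b) w = (a ≡ᵇ w) ∨ (b ≡ᵇ w)

deg : Graph → ℕ → ℕ
deg H w = length (filterᵇ (λ e → touches e w) (E H))

edgeCount : Graph → ℕ
edgeCount H = length (E H)

M1 : ℕ → Graph → ℕ
M1 α H = sum (map (λ w → deg H w ^ α) (V H))

M2 : Graph → ℕ
M2 H = sum (map (λ e → deg H (proj₁ e) * deg H (proj₂ e)) (E H))

alphaInv : ℕ → ℕ → Graph → ℕ
alphaInv l x H = sum (map (λ e → deg H (proj₁ e) ^ l * deg H (proj₂ e) ^ x
                                + deg H (proj₁ e) ^ x * deg H (proj₂ e) ^ l) (E H))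

deleteTwo : Graph → ℕ → ℕ → Graph
deleteTwo H u v =
  graph (filterᵇ (λ w → not ((w ≡ᵇ u) ∨ (w ≡ᵇ v))) (V H))
        (filterᵇ (λ e → not (touches e u ∨ touches e v)) (E H))

P2 : (Graph → ℕ) → Graph → ℕ
P2 f H = sum (map (λ e → f (deleteTwo H (proj₁ e) (proj₂ e))) (E H))

-- Subdivision graph S(G): original vertex a is relabelled 2a; the k-th edge (a,b)
-- gets a new vertex 2k+1, adjacent to 2a and 2b.
subdivEdges : ℕ → ℕ × ℕ → List (ℕ × ℕ)
subdivEdges k (a , b) = (2 * a , suc (2 * k)) ∷ (2 * b , suc (2 * k)) ∷ []

subdivision : Graph → Graph
subdivision G =
  graph (map (λ a → 2 * a) (V G) ++ map (λ k → suc (2 * k)) (upTo (length (E G))))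
        (concat (zipWith subdivEdges (upTo (length (E G))) (E G)))

m3M12 : Graph → ℕ
m3M12 H = edgeCount H ^ 3 * M1 2 H

module Submission where

-- Each edge k = vw of G is split in S(G) into the edges (2v, 2k+1) and (2w, 2k+1). Deleting both ends
-- of (2v, 2k+1) removes d(v) + 2 - 1 edges and lowers by one the degree of 2w and of every subdivision
-- vertex adjacent to 2v, so S(G) - {2v, 2k+1} has 2m - d(v) - 1 edges and first Zagreb index
-- M₁²(G) + 4m - d(v)² - 3d(v) - 2d(w). Thus P₂(m³M₁²)(S(G)) is a sum over the edges vw of G of a
-- polynomial in d(v), d(w), symmetric in v and w. Expanded in the basis 1, xᵏ + yᵏ (k ≤ 5), xy,
-- xy² + x²y, xy³ + x³y and summed with the handshake identity Σ_{uv∈E} (f(u) + f(v)) = Σ_u d(u) f(u),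
-- it becomes the stated combination of m, M₁ᵏ, M₂¹, α₁,₂ and α₁,₃.

open import Defs
open import Data.Bool using (Bool; true; false; not; _∧_; _∨_; T)
open import Data.Bool.Properties using (∨-comm; ∧-comm; T-∧; T-∨)
open import Data.Empty using (⊥; ⊥-elim)
open import Data.List using (List; []; _∷_; length; map; filterᵇ; _++_; upTo; zip; zipWith; concat)
open import Data.List.Properties using (map-cong; map-cong-local; map-∘; map-++; map-id; length-upTo)
open import Data.List.Membership.Propositional using (_∈_)
open import Data.List.Membership.Propositional.Properties using (∈-map⁺)
open import Data.List.Relation.Unary.All as All using (All; []; _∷_)
open import Data.List.Relation.Unary.All.Properties using (map⁻)
open import Data.List.Relation.Unary.Any using (here; there)
open import Data.List.Relation.Unary.AllPairs using (_∷_)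
open import Data.List.Relation.Unary.Unique.Propositional using (Unique)
open import Data.List.Relation.Unary.Unique.Propositional.Properties using (upTo⁺)
open import Data.Nat.ListAction using (sum)
open import Data.Product using (_×_; _,_; proj₁; proj₂)
open import Data.Sum using (_⊎_; inj₁; inj₂)
open import Function using (id; _∘_; Equivalence)
open import Relation.Binary.PropositionalEquality
open import Relation.Nullary using (¬_)
open import Relation.Nullary.Decidable using (dec-true; dec-false; proof)
open import Relation.Nullary.Reflects using (ofʸ; ofⁿ)

module Counting where

  open import Data.Nat using (ℕ; zero; suc; _+_; _*_; _^_; _≡ᵇ_; _≟_)
  open import Data.Nat.Properties
    using (suc-injective; *-suc; *-zeroʳ; *-identityʳ; *-distribˡ-+; *-distribʳ-+; +-identityʳ; +-commutativeSemigroup)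
  open import Data.Nat.Tactic.RingSolver using (solve-∀)
  open import Algebra.Properties.CommutativeSemigroup +-commutativeSemigroup using () renaming (interchange to +-interchange)
  open ≡-Reasoning

  𝟙 : Bool → ℕ
  𝟙 true  = 1
  𝟙 false = 0

  ≡ᵇ-true : ∀ {m n} → m ≡ n → (m ≡ᵇ n) ≡ true
  ≡ᵇ-true = dec-true (_ ≟ _)

  ≡ᵇ-false : ∀ {m n} → m ≢ n → (m ≡ᵇ n) ≡ false
  ≡ᵇ-false = dec-false (_ ≟ _)

  ≡ᵇ-sym : ∀ m n → (m ≡ᵇ n) ≡ (n ≡ᵇ m)
  ≡ᵇ-sym zero    zero    = refl
  ≡ᵇ-sym zero    (suc n) = refl
  ≡ᵇ-sym (suc m) zero    = refl
  ≡ᵇ-sym (suc m) (suc n) = ≡ᵇ-sym m n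

  ≡ᵇ-∧-≢ : ∀ x {u v} → u ≢ v → (x ≡ᵇ u) ∧ (x ≡ᵇ v) ≡ false
  ≡ᵇ-∧-≢ x {u} u≢v with x ≡ᵇ u | proof (x ≟ u)
  ... | false | _        = refl
  ... | true  | ofʸ refl = ≡ᵇ-false u≢v

  ¬T⇒≡false : ∀ {b} → ¬ T b → b ≡ false
  ¬T⇒≡false {false} _  = refl
  ¬T⇒≡false {true}  ¬t = ⊥-elim (¬t _)

  𝟙-∨ : ∀ P Q → P ∧ Q ≡ false → 𝟙 (P ∨ Q) ≡ 𝟙 P + 𝟙 Q
  𝟙-∨ true  false _ = refl
  𝟙-∨ false Q     _ = refl

  𝟙-∧ : ∀ P Q → 𝟙 (P ∧ Q) ≡ 𝟙 P * 𝟙 Q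
  𝟙-∧ true  true  = refl
  𝟙-∧ true  false = refl
  𝟙-∧ false Q     = refl

  𝟙-square-shift : ∀ D b → D ^ 2 + 2 * (𝟙 b * (D + 𝟙 b)) ≡ (D + 𝟙 b) ^ 2 + 𝟙 b
  𝟙-square-shift D true  = square-suc D
    where square-suc : ∀ x → x * (x * 1) + 2 * (1 * (x + 1)) ≡ (x + 1) * ((x + 1) * 1) + 1
          square-suc = solve-∀
  𝟙-square-shift D false = cong (_+ 0) (cong (_^ 2) (sym (+-identityʳ D)))

  module _ {A : Set} where

    sum-map-+ : (f g : A → ℕ) (xs : List A) →
                sum (map (λ x → f x + g x) xs) ≡ sum (map f xs) + sum (map g xs)
    sum-map-+ f g []       = refl
    sum-map-+ f g (x ∷ xs) = begin
      f x + g x + sum (map (λ x → f x + g x) xs)   ≡⟨ cong (f x + g x +_) (sum-map-+ f g xs) ⟩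
      f x + g x + (sum (map f xs) + sum (map g xs)) ≡⟨ +-interchange (f x) (g x) _ _ ⟩
      f x + sum (map f xs) + (g x + sum (map g xs)) ∎

    sum-map-*ˡ : (c : ℕ) (f : A → ℕ) (xs : List A) →
                 sum (map (λ x → c * f x) xs) ≡ c * sum (map f xs)
    sum-map-*ˡ c f []       = sym (*-zeroʳ c)
    sum-map-*ˡ c f (x ∷ xs) = trans (cong (c * f x +_) (sum-map-*ˡ c f xs)) (sym (*-distribˡ-+ c (f x) _))

    sum-map-*ʳ : (c : ℕ) (f : A → ℕ) (xs : List A) →
                 sum (map (λ x → f x * c) xs) ≡ sum (map f xs) * c
    sum-map-*ʳ c f []       = refl
    sum-map-*ʳ c f (x ∷ xs) = trans (cong (f x * c +_) (sum-map-*ʳ c f xs)) (sym (*-distribʳ-+ c (f x) _))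

    sum-map-const : (c : ℕ) (xs : List A) → sum (map (λ _ → c) xs) ≡ c * length xs
    sum-map-const c []       = sym (*-zeroʳ c)
    sum-map-const c (x ∷ xs) = trans (cong (c +_) (sum-map-const c xs)) (sym (*-suc c (length xs)))

    sum-map-linear : (a : ℕ) (f g h : A → ℕ) (xs : List A) →
      sum (map (λ x → f x + (a * g x + h x)) xs) ≡ sum (map f xs) + (a * sum (map g xs) + sum (map h xs))
    sum-map-linear a f g h xs = begin
      sum (map (λ x → f x + (a * g x + h x)) xs)
        ≡⟨ sum-map-+ f _ xs ⟩
      sum (map f xs) + sum (map (λ x → a * g x + h x) xs)
        ≡⟨ cong (sum (map f xs) +_) (sum-map-+ _ h xs) ⟩
      sum (map f xs) + (sum (map (λ x → a * g x) xs) + sum (map h xs))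
        ≡⟨ cong (λ s → sum (map f xs) + (s + sum (map h xs))) (sum-map-*ˡ a g xs) ⟩
      sum (map f xs) + (a * sum (map g xs) + sum (map h xs)) ∎

    length-filterᵇ : (p : A → Bool) (xs : List A) → length (filterᵇ p xs) ≡ sum (map (λ x → 𝟙 (p x)) xs)
    length-filterᵇ p []       = refl
    length-filterᵇ p (x ∷ xs) with p x
    ... | true  = cong suc (length-filterᵇ p xs)
    ... | false = length-filterᵇ p xs

    sum-map-filterᵇ : (p : A → Bool) (g : A → ℕ) (xs : List A) →
                      sum (map g (filterᵇ p xs)) ≡ sum (map (λ x → 𝟙 (p x) * g x) xs)
    sum-map-filterᵇ p g []       = refl
    sum-map-filterᵇ p g (x ∷ xs) with p x
    ... | true  = cong₂ _+_ (sym (+-identityʳ (g x))) (sum-map-filterᵇ p g xs)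
    ... | false = sum-map-filterᵇ p g xs

    filterᵇ-filterᵇ : (p q : A → Bool) (xs : List A) →
                      filterᵇ p (filterᵇ q xs) ≡ filterᵇ (λ x → q x ∧ p x) xs
    filterᵇ-filterᵇ p q []       = refl
    filterᵇ-filterᵇ p q (x ∷ xs) with q x
    ... | false = filterᵇ-filterᵇ p q xs
    ... | true with p x
    ...   | true  = cong (x ∷_) (filterᵇ-filterᵇ p q xs)
    ...   | false = filterᵇ-filterᵇ p q xs

    filterᵇ-cong : {p q : A → Bool} → (∀ x → p x ≡ q x) → (xs : List A) → filterᵇ p xs ≡ filterᵇ q xs
    filterᵇ-cong p≗q []       = refl
    filterᵇ-cong {p} {q} p≗q (x ∷ xs) rewrite p≗q x with q x
    ... | true  = cong (x ∷_) (filterᵇ-cong p≗q xs)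
    ... | false = filterᵇ-cong p≗q xs

    filterᵇ-comm : (p q : A → Bool) (xs : List A) → filterᵇ p (filterᵇ q xs) ≡ filterᵇ q (filterᵇ p xs)
    filterᵇ-comm p q xs = begin
      filterᵇ p (filterᵇ q xs)          ≡⟨ filterᵇ-filterᵇ p q xs ⟩
      filterᵇ (λ x → q x ∧ p x) xs      ≡⟨ filterᵇ-cong (λ x → ∧-comm (q x) (p x)) xs ⟩
      filterᵇ (λ x → p x ∧ q x) xs      ≡⟨ sym (filterᵇ-filterᵇ q p xs) ⟩
      filterᵇ q (filterᵇ p xs)          ∎

    filterᵇ-none : {p : A → Bool} → (∀ x → p x ≡ false) → (xs : List A) → filterᵇ p xs ≡ []
    filterᵇ-none p≗false []       = refl
    filterᵇ-none p≗false (x ∷ xs) rewrite p≗false x = filterᵇ-none p≗false xs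

    length-filterᵇ-not-∨ : (p q : A → Bool) (xs : List A) →
      length (filterᵇ (λ x → not (p x ∨ q x)) xs) + (length (filterᵇ p xs) + length (filterᵇ q xs))
      ≡ length xs + length (filterᵇ (λ x → p x ∧ q x) xs)
    length-filterᵇ-not-∨ p q xs = begin
      length (filterᵇ neither xs) + (length (filterᵇ p xs) + length (filterᵇ q xs))
        ≡⟨ cong₂ _+_ (length-filterᵇ neither xs) (cong₂ _+_ (length-filterᵇ p xs) (length-filterᵇ q xs)) ⟩
      sum (map (𝟙 ∘ neither) xs) + (sum (map (𝟙 ∘ p) xs) + sum (map (𝟙 ∘ q) xs))
        ≡⟨ cong (sum (map (𝟙 ∘ neither) xs) +_) (sym (sum-map-+ (𝟙 ∘ p) (𝟙 ∘ q) xs)) ⟩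
      sum (map (𝟙 ∘ neither) xs) + sum (map (λ x → 𝟙 (p x) + 𝟙 (q x)) xs)
        ≡⟨ sym (sum-map-+ (𝟙 ∘ neither) _ xs) ⟩
      sum (map (λ x → 𝟙 (neither x) + (𝟙 (p x) + 𝟙 (q x))) xs)
        ≡⟨ cong sum (map-cong (λ x → pointwise (p x) (q x)) xs) ⟩
      sum (map (λ x → 1 + 𝟙 (p x ∧ q x)) xs)
        ≡⟨ sum-map-+ (λ _ → 1) (λ x → 𝟙 (p x ∧ q x)) xs ⟩
      sum (map (λ _ → 1) xs) + sum (map (λ x → 𝟙 (p x ∧ q x)) xs)
        ≡⟨ cong₂ _+_ (trans (sum-map-const 1 xs) (+-identityʳ (length xs))) (sym (length-filterᵇ _ xs)) ⟩
      length xs + length (filterᵇ (λ x → p x ∧ q x) xs) ∎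
      where
      neither : A → Bool
      neither x = not (p x ∨ q x)
      pointwise : ∀ P Q → 𝟙 (not (P ∨ Q)) + (𝟙 P + 𝟙 Q) ≡ 1 + 𝟙 (P ∧ Q)
      pointwise true  true  = refl
      pointwise true  false = refl
      pointwise false true  = refl
      pointwise false false = refl

  module _ {A B : Set} where

    sum-map-comm : (h : A → B → ℕ) (xs : List A) (ys : List B) →
      sum (map (λ x → sum (map (h x) ys)) xs) ≡ sum (map (λ y → sum (map (λ x → h x y) xs)) ys)
    sum-map-comm h []       ys = sym (sum-map-const 0 ys)
    sum-map-comm h (x ∷ xs) ys =
      trans (cong (sum (map (h x) ys) +_) (sum-map-comm h xs ys))
            (sym (sum-map-+ (h x) (λ y → sum (map (λ x → h x y) xs)) ys))

    map-proj₁-zip : (xs : List A) (ys : List B) → length xs ≡ length ys → map proj₁ (zip xs ys) ≡ xs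
    map-proj₁-zip []       []       _   = refl
    map-proj₁-zip (x ∷ xs) (y ∷ ys) len = cong (x ∷_) (map-proj₁-zip xs ys (suc-injective len))

    map-proj₂-zip : (xs : List A) (ys : List B) → length xs ≡ length ys → map proj₂ (zip xs ys) ≡ ys
    map-proj₂-zip []       []       _   = refl
    map-proj₂-zip (x ∷ xs) (y ∷ ys) len = cong (y ∷_) (map-proj₂-zip xs ys (suc-injective len))

  module _ {A : Set} (key : A → ℕ) where

    sum-𝟙-absent : ∀ (h : A → ℕ) {k} (xs : List A) → All (λ t → key t ≢ k) xs →
                   sum (map (λ t → 𝟙 (key t ≡ᵇ k) * h t) xs) ≡ 0
    sum-𝟙-absent h []       []          = refl
    sum-𝟙-absent h (t ∷ xs) (t≢k ∷ xs≢k) rewrite ≡ᵇ-false t≢k = sum-𝟙-absent h xs xs≢k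

    sum-𝟙-unique : ∀ (h : A → ℕ) {xs t₀} → Unique (map key xs) → t₀ ∈ xs →
                   sum (map (λ t → 𝟙 (key t ≡ᵇ key t₀) * h t) xs) ≡ h t₀
    sum-𝟙-unique h {t ∷ xs} (t≢xs ∷ _) (here refl)
      rewrite ≡ᵇ-true {key t} refl | sum-𝟙-absent h xs (map⁻ (All.map (_∘ sym) t≢xs)) =
        trans (+-identityʳ _) (+-identityʳ _)
    sum-𝟙-unique h (t≢xs ∷ unique) (there t₀∈xs)
      rewrite ≡ᵇ-false (All.lookup t≢xs (∈-map⁺ key t₀∈xs)) = sum-𝟙-unique h unique t₀∈xs

    sum-𝟙-unique₁ : ∀ {xs t₀} → Unique (map key xs) → t₀ ∈ xs →
                    sum (map (λ t → 𝟙 (key t ≡ᵇ key t₀)) xs) ≡ 1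
    sum-𝟙-unique₁ {xs} unique t₀∈xs =
      trans (cong sum (map-cong (λ t → sym (*-identityʳ (𝟙 (key t ≡ᵇ key _)))) xs))
            (sum-𝟙-unique (λ _ → 1) unique t₀∈xs)

module GraphCounting where

  open Counting
  open import Data.Nat using (ℕ; _+_; _*_; _<_; _≡ᵇ_)
  open import Data.Nat.Properties using (+-identityʳ; *-distribʳ-+; <⇒≢; ≡ᵇ⇒≡)
  open ≡-Reasoning

  codeg : Graph → ℕ → ℕ → ℕ
  codeg H p q = length (filterᵇ (λ e → touches e p ∧ touches e q) (E H))

  edgeCount-deleteTwo : ∀ H p q → edgeCount (deleteTwo H p q) + (deg H p + deg H q) ≡ edgeCount H + codeg H p q
  edgeCount-deleteTwo H p q = length-filterᵇ-not-∨ (λ e → touches e p) (λ e → touches e q) (E H)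

  codeg-comm : ∀ H p q → codeg H p q ≡ codeg H q p
  codeg-comm H p q = cong length (filterᵇ-cong (λ e → ∧-comm (touches e p) (touches e q)) (E H))

  𝟙-touches : ∀ {a b} u → a ≢ b → 𝟙 (touches (a , b) u) ≡ 𝟙 (u ≡ᵇ a) + 𝟙 (u ≡ᵇ b)
  𝟙-touches {a} {b} u a≢b rewrite ≡ᵇ-sym a u | ≡ᵇ-sym b u = 𝟙-∨ (u ≡ᵇ a) (u ≡ᵇ b) (≡ᵇ-∧-≢ u a≢b)

  touches⇒endpoint : ∀ e {w} → T (touches e w) → proj₁ e ≡ w ⊎ proj₂ e ≡ w
  touches⇒endpoint (a , b) {w} t with Equivalence.to T-∨ t
  ... | inj₁ ta = inj₁ (≡ᵇ⇒≡ a w ta)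
  ... | inj₂ tb = inj₂ (≡ᵇ⇒≡ b w tb)

  touches-three-distinct : ∀ {z p q} → z ≢ p → z ≢ q → p ≢ q →
                           ∀ e → touches e z ∧ (touches e p ∧ touches e q) ≡ false
  touches-three-distinct {z} {p} {q} z≢p z≢q p≢q e = ¬T⇒≡false λ all3 →
    let tz , tpq = Equivalence.to T-∧ all3
        tp , tq  = Equivalence.to T-∧ tpq
    in pigeonhole (touches⇒endpoint e tz) (touches⇒endpoint e tp) (touches⇒endpoint e tq)
    where
    pigeonhole : proj₁ e ≡ z ⊎ proj₂ e ≡ z → proj₁ e ≡ p ⊎ proj₂ e ≡ p → proj₁ e ≡ q ⊎ proj₂ e ≡ q → ⊥
    pigeonhole (inj₁ refl) (inj₁ refl) _           = z≢p refl
    pigeonhole (inj₂ refl) (inj₂ refl) _           = z≢p refl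
    pigeonhole (inj₁ refl) (inj₂ refl) (inj₁ refl) = z≢q refl
    pigeonhole (inj₁ refl) (inj₂ refl) (inj₂ refl) = p≢q refl
    pigeonhole (inj₂ refl) (inj₁ refl) (inj₁ refl) = p≢q refl
    pigeonhole (inj₂ refl) (inj₁ refl) (inj₂ refl) = z≢q refl

  deg-deleteTwo : ∀ H {p q z} → z ≢ p → z ≢ q → p ≢ q →
                  deg (deleteTwo H p q) z + (codeg H z p + codeg H z q) ≡ deg H z
  deg-deleteTwo H {p} {q} {z} z≢p z≢q p≢q = begin
    deg (deleteTwo H p q) z + (codeg H z p + codeg H z q)
      ≡⟨ cong₂ _+_ (cong length (filterᵇ-comm tz neither (E H)))
                   (cong₂ _+_ (cong length (sym (filterᵇ-filterᵇ tp tz (E H))))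
                              (cong length (sym (filterᵇ-filterᵇ tq tz (E H))))) ⟩
    length (filterᵇ neither Ez) + (length (filterᵇ tp Ez) + length (filterᵇ tq Ez))
      ≡⟨ length-filterᵇ-not-∨ tp tq Ez ⟩
    length Ez + length (filterᵇ (λ e → tp e ∧ tq e) Ez)
      ≡⟨ cong (λ es → length Ez + length es) (trans (filterᵇ-filterᵇ _ tz (E H))
                 (filterᵇ-none (touches-three-distinct z≢p z≢q p≢q) (E H))) ⟩
    length Ez + 0
      ≡⟨ +-identityʳ (deg H z) ⟩
    deg H z ∎
    where
    tz tp tq neither : ℕ × ℕ → Bool
    tz e = touches e z
    tp e = touches e p
    tq e = touches e q
    neither e = not (tp e ∨ tq e)
    Ez : List (ℕ × ℕ)
    Ez = filterᵇ tz (E H)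

  unique-vertices : ∀ {G} → IsSimpleGraph G → Unique (map id (V G))
  unique-vertices {G} (uniqueV , _) = subst Unique (sym (map-id (V G))) uniqueV

  handshake : ∀ G → IsSimpleGraph G → (f : ℕ → ℕ) →
              sum (map (λ e → f (proj₁ e) + f (proj₂ e)) (E G)) ≡ sum (map (λ u → deg G u * f u) (V G))
  handshake G simple@(_ , _ , edgesOK) f = sym (begin
    sum (map (λ u → deg G u * f u) (V G))
      ≡⟨ cong sum (map-cong (λ u → trans (cong (_* f u) (length-filterᵇ _ (E G)))
                                          (sym (sum-map-*ʳ (f u) _ (E G)))) (V G)) ⟩
    sum (map (λ u → sum (map (λ e → 𝟙 (touches e u) * f u) (E G))) (V G))
      ≡⟨ sum-map-comm (λ u e → 𝟙 (touches e u) * f u) (V G) (E G) ⟩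
    sum (map (λ e → sum (map (λ u → 𝟙 (touches e u) * f u) (V G))) (E G))
      ≡⟨ cong sum (map-cong-local (All.map incidences edgesOK)) ⟩
    sum (map (λ e → f (proj₁ e) + f (proj₂ e)) (E G)) ∎)
    where
    incidences : ∀ {e} → (proj₁ e < proj₂ e) × (proj₁ e ∈ V G) × (proj₂ e ∈ V G) →
                 sum (map (λ u → 𝟙 (touches e u) * f u) (V G)) ≡ f (proj₁ e) + f (proj₂ e)
    incidences {a , b} (a<b , a∈V , b∈V) = begin
      sum (map (λ u → 𝟙 (touches (a , b) u) * f u) (V G))
        ≡⟨ cong sum (map-cong split (V G)) ⟩
      sum (map (λ u → 𝟙 (u ≡ᵇ a) * f u + 𝟙 (u ≡ᵇ b) * f u) (V G))
        ≡⟨ sum-map-+ (λ u → 𝟙 (u ≡ᵇ a) * f u) (λ u → 𝟙 (u ≡ᵇ b) * f u) (V G) ⟩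
      sum (map (λ u → 𝟙 (u ≡ᵇ a) * f u) (V G)) + sum (map (λ u → 𝟙 (u ≡ᵇ b) * f u) (V G))
        ≡⟨ cong₂ _+_ (sum-𝟙-unique id f (unique-vertices simple) a∈V)
                     (sum-𝟙-unique id f (unique-vertices simple) b∈V) ⟩
      f a + f b ∎
      where
      split : ∀ u → 𝟙 (touches (a , b) u) * f u ≡ 𝟙 (u ≡ᵇ a) * f u + 𝟙 (u ≡ᵇ b) * f u
      split u rewrite 𝟙-touches u (<⇒≢ a<b) = *-distribʳ-+ (f u) (𝟙 (u ≡ᵇ a)) (𝟙 (u ≡ᵇ b))

module SubdivisionCounting (G : Graph) (simple : IsSimpleGraph G) where

  open Counting
  open GraphCounting
  open import Data.Nat using (ℕ; suc; _+_; _*_; _^_; _<_; _≡ᵇ_; _≟_)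
  open import Data.Nat.Properties
    using (even≢odd; *-cancelˡ-≡; suc-injective; <⇒≢; +-cancelʳ-≡; +-assoc; +-identityʳ; *-distribʳ-+; *-comm)
  open import Data.Nat.ListAction.Properties using (sum-++)
  open import Data.Bool.Properties using (∨-identityʳ)
  open import Data.List.Properties using (length-map)
  open ≡-Reasoning

  m : ℕ
  m = edgeCount G

  S : Graph
  S = subdivision G

  indexedEdges : List (ℕ × (ℕ × ℕ))
  indexedEdges = zip (upTo m) (E G)

  halfEdge₁ halfEdge₂ : ℕ × (ℕ × ℕ) → ℕ × ℕ
  halfEdge₁ (k , (a , b)) = 2 * a , suc (2 * k)
  halfEdge₂ (k , (a , b)) = 2 * b , suc (2 * k)

  ≡ᵇ-double : ∀ x u → (2 * x ≡ᵇ 2 * u) ≡ (x ≡ᵇ u)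
  ≡ᵇ-double x u with x ≡ᵇ u | proof (x ≟ u)
  ... | true  | ofʸ refl = ≡ᵇ-true {2 * x} refl
  ... | false | ofⁿ x≢u  = ≡ᵇ-false (x≢u ∘ *-cancelˡ-≡ x u 2)

  touches-even : ∀ x j u → touches (2 * x , suc (2 * j)) (2 * u) ≡ (x ≡ᵇ u)
  touches-even x j u rewrite ≡ᵇ-double x u | ≡ᵇ-false (even≢odd u j ∘ sym) = ∨-identityʳ (x ≡ᵇ u)

  touches-odd : ∀ x j i → touches (2 * x , suc (2 * j)) (suc (2 * i)) ≡ (j ≡ᵇ i)
  touches-odd x j i rewrite ≡ᵇ-false (even≢odd x i) = ≡ᵇ-double j i

  edges-indexedEdges : map proj₂ indexedEdges ≡ E G
  edges-indexedEdges = map-proj₂-zip (upTo m) (E G) (length-upTo m)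

  keys-indexedEdges : map proj₁ indexedEdges ≡ upTo m
  keys-indexedEdges = map-proj₁-zip (upTo m) (E G) (length-upTo m)

  unique-keys : Unique (map proj₁ indexedEdges)
  unique-keys = subst Unique (sym keys-indexedEdges) (upTo⁺ m)

  length-indexedEdges : length indexedEdges ≡ m
  length-indexedEdges = trans (sym (length-map proj₂ indexedEdges)) (cong length edges-indexedEdges)

  edge-properties : ∀ {k a b} → (k , (a , b)) ∈ indexedEdges → a < b × a ∈ V G × b ∈ V G
  edge-properties t∈ = All.lookup (proj₂ (proj₂ simple)) (subst (_ ∈_) edges-indexedEdges (∈-map⁺ proj₂ t∈))

  endpoints-distinct : ∀ {k a b} → (k , (a , b)) ∈ indexedEdges → a ≢ b
  endpoints-distinct t∈ = <⇒≢ (proj₁ (edge-properties t∈))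

  sum-E-indexed : (f : ℕ × ℕ → ℕ) → sum (map f (E G)) ≡ sum (map (f ∘ proj₂) indexedEdges)
  sum-E-indexed f = trans (cong (sum ∘ map f) (sym edges-indexedEdges)) (cong sum (sym (map-∘ indexedEdges)))

  deg-indexed : ∀ u → deg G u ≡ sum (map (λ t → 𝟙 (touches (proj₂ t) u)) indexedEdges)
  deg-indexed u = trans (length-filterᵇ _ (E G)) (sum-E-indexed (λ e → 𝟙 (touches e u)))

  sum-E-S : (g : ℕ × ℕ → ℕ) →
            sum (map g (E S)) ≡ sum (map (λ t → g (halfEdge₁ t) + g (halfEdge₂ t)) indexedEdges)
  sum-E-S g = halves (upTo m) (E G)
    where
    halves : ∀ ks es → sum (map g (concat (zipWith subdivEdges ks es)))
                       ≡ sum (map (λ t → g (halfEdge₁ t) + g (halfEdge₂ t)) (zip ks es))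
    halves []       es       = refl
    halves (k ∷ ks) []       = refl
    halves (k ∷ ks) (e ∷ es) = trans (cong (λ s → g _ + (g _ + s)) (halves ks es)) (sym (+-assoc (g _) (g _) _))

  sum-V-S : (g : ℕ → ℕ) → sum (map g (V S))
            ≡ sum (map (λ u → g (2 * u)) (V G)) + sum (map (λ t → g (suc (2 * proj₁ t))) indexedEdges)
  sum-V-S g = begin
    sum (map g (map (2 *_) (V G) ++ map (suc ∘ (2 *_)) (upTo m)))
      ≡⟨ cong sum (map-++ g (map (2 *_) (V G)) _) ⟩
    sum (map g (map (2 *_) (V G)) ++ map g (map (suc ∘ (2 *_)) (upTo m)))
      ≡⟨ sum-++ (map g (map (2 *_) (V G))) _ ⟩
    sum (map g (map (2 *_) (V G))) + sum (map g (map (suc ∘ (2 *_)) (upTo m)))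
      ≡⟨ cong₂ _+_ (cong sum (sym (map-∘ (V G))))
                   (cong (sum ∘ map g ∘ map (suc ∘ (2 *_))) (sym keys-indexedEdges)) ⟩
    sum (map (λ u → g (2 * u)) (V G)) + sum (map g (map (suc ∘ (2 *_)) (map proj₁ indexedEdges)))
      ≡⟨ cong (sum (map (λ u → g (2 * u)) (V G)) +_)
              (cong sum (trans (sym (map-∘ _)) (sym (map-∘ indexedEdges)))) ⟩
    sum (map (λ u → g (2 * u)) (V G)) + sum (map (λ t → g (suc (2 * proj₁ t))) indexedEdges) ∎

  count-E-S : (P : ℕ × ℕ → Bool) → length (filterᵇ P (E S))
              ≡ sum (map (λ t → 𝟙 (P (halfEdge₁ t)) + 𝟙 (P (halfEdge₂ t))) indexedEdges)
  count-E-S P = trans (length-filterᵇ P (E S)) (sum-E-S (𝟙 ∘ P))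

  count-E-S-none : (P : ℕ × ℕ → Bool) → (∀ t → 𝟙 (P (halfEdge₁ t)) + 𝟙 (P (halfEdge₂ t)) ≡ 0) →
                   length (filterᵇ P (E S)) ≡ 0
  count-E-S-none P none =
    trans (count-E-S P) (trans (cong sum (map-cong none indexedEdges)) (sum-map-const 0 indexedEdges))

  edgeCount-S : edgeCount S ≡ 2 * m
  edgeCount-S = begin
    length (E S)                              ≡⟨ sym (trans (sum-map-const 1 (E S)) (+-identityʳ _)) ⟩
    sum (map (λ _ → 1) (E S))                 ≡⟨ sum-E-S (λ _ → 1) ⟩
    sum (map (λ _ → 2) indexedEdges)          ≡⟨ sum-map-const 2 indexedEdges ⟩
    2 * length indexedEdges                   ≡⟨ cong (2 *_) length-indexedEdges ⟩
    2 * m                                     ∎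

  deg-S-even : ∀ u → deg S (2 * u) ≡ deg G u
  deg-S-even u = begin
    deg S (2 * u)
      ≡⟨ count-E-S (λ e → touches e (2 * u)) ⟩
    sum (map (λ t → 𝟙 (touches (halfEdge₁ t) (2 * u)) + 𝟙 (touches (halfEdge₂ t) (2 * u))) indexedEdges)
      ≡⟨ cong sum (map-cong-local (All.tabulate endpoint)) ⟩
    sum (map (λ t → 𝟙 (touches (proj₂ t) u)) indexedEdges)
      ≡⟨ sym (deg-indexed u) ⟩
    deg G u ∎
    where
    endpoint : ∀ {t} → t ∈ indexedEdges →
               𝟙 (touches (halfEdge₁ t) (2 * u)) + 𝟙 (touches (halfEdge₂ t) (2 * u)) ≡ 𝟙 (touches (proj₂ t) u)
    endpoint {j , (x , y)} t∈ rewrite touches-even x j u | touches-even y j u | 𝟙-touches u (endpoints-distinct t∈) =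
      cong₂ _+_ (cong 𝟙 (≡ᵇ-sym x u)) (cong 𝟙 (≡ᵇ-sym y u))

  deg-S-odd : ∀ {k e} → (k , e) ∈ indexedEdges → deg S (suc (2 * k)) ≡ 2
  deg-S-odd {k} ke∈ = begin
    deg S (suc (2 * k))
      ≡⟨ count-E-S (λ e → touches e (suc (2 * k))) ⟩
    sum (map (λ t → 𝟙 (touches (halfEdge₁ t) (suc (2 * k))) + 𝟙 (touches (halfEdge₂ t) (suc (2 * k)))) indexedEdges)
      ≡⟨ cong sum (map-cong bothHalves indexedEdges) ⟩
    sum (map (λ t → 𝟙 (proj₁ t ≡ᵇ k) * 2) indexedEdges)
      ≡⟨ sum-𝟙-unique proj₁ (λ _ → 2) unique-keys ke∈ ⟩
    2 ∎
    where
    bothHalves : ∀ t → 𝟙 (touches (halfEdge₁ t) (suc (2 * k))) + 𝟙 (touches (halfEdge₂ t) (suc (2 * k)))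
                       ≡ 𝟙 (proj₁ t ≡ᵇ k) * 2
    bothHalves (j , (x , y)) rewrite touches-odd x j k | touches-odd y j k = double (𝟙 (j ≡ᵇ k))
      where double : ∀ n → n + n ≡ n * 2
            double n = trans (cong (n +_) (sym (+-identityʳ n))) (*-comm 2 n)

  codeg-S-even-odd : ∀ {k e} → (k , e) ∈ indexedEdges → ∀ u → codeg S (2 * u) (suc (2 * k)) ≡ 𝟙 (touches e u)
  codeg-S-even-odd {k} {e} ke∈ u = begin
    codeg S (2 * u) (suc (2 * k))
      ≡⟨ count-E-S joins ⟩
    sum (map (λ t → 𝟙 (joins (halfEdge₁ t)) + 𝟙 (joins (halfEdge₂ t))) indexedEdges)
      ≡⟨ cong sum (map-cong-local (All.tabulate halves)) ⟩
    sum (map (λ t → 𝟙 (proj₁ t ≡ᵇ k) * 𝟙 (touches (proj₂ t) u)) indexedEdges)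
      ≡⟨ sum-𝟙-unique proj₁ (λ t → 𝟙 (touches (proj₂ t) u)) unique-keys ke∈ ⟩
    𝟙 (touches e u) ∎
    where
    joins : ℕ × ℕ → Bool
    joins e = touches e (2 * u) ∧ touches e (suc (2 * k))
    halves : ∀ {t} → t ∈ indexedEdges →
             𝟙 (joins (halfEdge₁ t)) + 𝟙 (joins (halfEdge₂ t)) ≡ 𝟙 (proj₁ t ≡ᵇ k) * 𝟙 (touches (proj₂ t) u)
    halves {j , (x , y)} t∈
      rewrite touches-even x j u | touches-even y j u | touches-odd x j k | touches-odd y j k
            | 𝟙-∧ (x ≡ᵇ u) (j ≡ᵇ k) | 𝟙-∧ (y ≡ᵇ u) (j ≡ᵇ k) | 𝟙-touches u (endpoints-distinct t∈)
            | ≡ᵇ-sym u x | ≡ᵇ-sym u y =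
      trans (sym (*-distribʳ-+ (𝟙 (j ≡ᵇ k)) (𝟙 (x ≡ᵇ u)) (𝟙 (y ≡ᵇ u)))) (*-comm _ (𝟙 (j ≡ᵇ k)))

  codeg-S-even : ∀ {u v} → u ≢ v → codeg S (2 * u) (2 * v) ≡ 0
  codeg-S-even {u} {v} u≢v = count-E-S-none _ never
    where
    never : ∀ t → 𝟙 (touches (halfEdge₁ t) (2 * u) ∧ touches (halfEdge₁ t) (2 * v))
                  + 𝟙 (touches (halfEdge₂ t) (2 * u) ∧ touches (halfEdge₂ t) (2 * v)) ≡ 0
    never (j , (x , y))
      rewrite touches-even x j u | touches-even x j v | touches-even y j u | touches-even y j v
            | ≡ᵇ-∧-≢ x u≢v | ≡ᵇ-∧-≢ y u≢v = refl

  codeg-S-odd : ∀ {i k} → i ≢ k → codeg S (suc (2 * i)) (suc (2 * k)) ≡ 0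
  codeg-S-odd {i} {k} i≢k = count-E-S-none _ never
    where
    never : ∀ t → 𝟙 (touches (halfEdge₁ t) (suc (2 * i)) ∧ touches (halfEdge₁ t) (suc (2 * k)))
                  + 𝟙 (touches (halfEdge₂ t) (suc (2 * i)) ∧ touches (halfEdge₂ t) (suc (2 * k))) ≡ 0
    never (j , (x , y))
      rewrite touches-odd x j i | touches-odd x j k | touches-odd y j i | touches-odd y j k
            | ≡ᵇ-∧-≢ j i≢k = refl

  sum-V-deleteTwo-S : ∀ v k (g : ℕ → ℕ) → sum (map g (V (deleteTwo S (2 * v) (suc (2 * k)))))
    ≡ sum (map (λ u → 𝟙 (not (u ≡ᵇ v)) * g (2 * u)) (V G))
      + sum (map (λ t → 𝟙 (not (proj₁ t ≡ᵇ k)) * g (suc (2 * proj₁ t))) indexedEdges)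
  sum-V-deleteTwo-S v k g = begin
    sum (map g (filterᵇ kept (V S)))
      ≡⟨ sum-map-filterᵇ kept g (V S) ⟩
    sum (map (λ w → 𝟙 (kept w) * g w) (V S))
      ≡⟨ sum-V-S (λ w → 𝟙 (kept w) * g w) ⟩
    sum (map (λ u → 𝟙 (kept (2 * u)) * g (2 * u)) (V G))
      + sum (map (λ t → 𝟙 (kept (suc (2 * proj₁ t))) * g (suc (2 * proj₁ t))) indexedEdges)
      ≡⟨ cong₂ _+_ (cong sum (map-cong (λ u → cong (λ b → 𝟙 b * g (2 * u)) (keptEven u)) (V G)))
                   (cong sum (map-cong (λ t → cong (λ b → 𝟙 b * g (suc (2 * proj₁ t))) (keptOdd (proj₁ t))) indexedEdges)) ⟩
    sum (map (λ u → 𝟙 (not (u ≡ᵇ v)) * g (2 * u)) (V G))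
      + sum (map (λ t → 𝟙 (not (proj₁ t ≡ᵇ k)) * g (suc (2 * proj₁ t))) indexedEdges) ∎
    where
    kept : ℕ → Bool
    kept w = not ((w ≡ᵇ 2 * v) ∨ (w ≡ᵇ suc (2 * k)))
    keptEven : ∀ u → kept (2 * u) ≡ not (u ≡ᵇ v)
    keptEven u rewrite ≡ᵇ-double u v | ≡ᵇ-false (even≢odd u k) = cong not (∨-identityʳ (u ≡ᵇ v))
    keptOdd : ∀ j → kept (suc (2 * j)) ≡ not (j ≡ᵇ k)
    keptOdd j rewrite ≡ᵇ-false (even≢odd v j ∘ sym) = cong not (≡ᵇ-double j k)

  module HalfEdge {k e} (ke∈ : (k , e) ∈ indexedEdges) {v w} (v≢w : v ≢ w) (v∈V : v ∈ V G) (w∈V : w ∈ V G)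
                  (ends : ∀ u → touches e u ≡ touches (v , w) u) where

    R : Graph
    R = deleteTwo S (2 * v) (suc (2 * k))

    e-touches-v : touches e v ≡ true
    e-touches-v = trans (ends v) (cong (_∨ (w ≡ᵇ v)) (≡ᵇ-true {v} refl))

    e-touches-other : ∀ {u} → u ≢ v → touches e u ≡ (u ≡ᵇ w)
    e-touches-other {u} u≢v rewrite ends u | ≡ᵇ-false (u≢v ∘ sym) = ≡ᵇ-sym w u

    edgeCount-R : edgeCount R + (deg G v + 2) ≡ 2 * m + 1
    edgeCount-R = begin
      edgeCount R + (deg G v + 2)
        ≡⟨ cong (λ d → edgeCount R + (d + 2)) (sym (deg-S-even v)) ⟩
      edgeCount R + (deg S (2 * v) + 2)
        ≡⟨ cong (λ d → edgeCount R + (deg S (2 * v) + d)) (sym (deg-S-odd ke∈)) ⟩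
      edgeCount R + (deg S (2 * v) + deg S (suc (2 * k)))
        ≡⟨ edgeCount-deleteTwo S (2 * v) (suc (2 * k)) ⟩
      edgeCount S + codeg S (2 * v) (suc (2 * k))
        ≡⟨ cong₂ _+_ edgeCount-S (trans (codeg-S-even-odd ke∈ v) (cong 𝟙 e-touches-v)) ⟩
      2 * m + 1 ∎

    deg-R-even : ∀ {u} → u ≢ v → deg R (2 * u) + 𝟙 (u ≡ᵇ w) ≡ deg G u
    deg-R-even {u} u≢v = begin
      deg R (2 * u) + 𝟙 (u ≡ᵇ w)
        ≡⟨ cong (deg R (2 * u) +_) (sym (cong₂ _+_ (codeg-S-even u≢v)
                                                    (trans (codeg-S-even-odd ke∈ u) (cong 𝟙 (e-touches-other u≢v))))) ⟩
      deg R (2 * u) + (codeg S (2 * u) (2 * v) + codeg S (2 * u) (suc (2 * k)))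
        ≡⟨ deg-deleteTwo S (u≢v ∘ *-cancelˡ-≡ u v 2) (even≢odd u k) (even≢odd v k) ⟩
      deg S (2 * u)
        ≡⟨ deg-S-even u ⟩
      deg G u ∎

    deg-R-odd : ∀ {j e′} → (j , e′) ∈ indexedEdges → j ≢ k → deg R (suc (2 * j)) + 𝟙 (touches e′ v) ≡ 2
    deg-R-odd {j} {e′} je′∈ j≢k = begin
      deg R (suc (2 * j)) + 𝟙 (touches e′ v)
        ≡⟨ cong (deg R (suc (2 * j)) +_) (sym (trans (cong₂ _+_ incident (codeg-S-odd j≢k)) (+-identityʳ _))) ⟩
      deg R (suc (2 * j)) + (codeg S (suc (2 * j)) (2 * v) + codeg S (suc (2 * j)) (suc (2 * k)))
        ≡⟨ deg-deleteTwo S (even≢odd v j ∘ sym) (j≢k ∘ *-cancelˡ-≡ j k 2 ∘ suc-injective) (even≢odd v k) ⟩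
      deg S (suc (2 * j))
        ≡⟨ deg-S-odd je′∈ ⟩
      2 ∎
      where
      incident : codeg S (suc (2 * j)) (2 * v) ≡ 𝟙 (touches e′ v)
      incident = trans (codeg-comm S _ _) (codeg-S-even-odd je′∈ v)

    evenPart oddPart : ℕ
    evenPart = sum (map (λ u → 𝟙 (not (u ≡ᵇ v)) * deg R (2 * u) ^ 2) (V G))
    oddPart  = sum (map (λ t → 𝟙 (not (proj₁ t ≡ᵇ k)) * deg R (suc (2 * proj₁ t)) ^ 2) indexedEdges)

    M1-R : M1 2 R ≡ evenPart + oddPart
    M1-R = sum-V-deleteTwo-S v k (λ x → deg R x ^ 2)

    evenPart-value : evenPart + (2 * deg G w + deg G v ^ 2) ≡ M1 2 G + 1
    evenPart-value = begin
      evenPart + (2 * deg G w + deg G v ^ 2)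
        ≡⟨ cong (evenPart +_) (sym (cong₂ (λ x y → 2 * x + y) (sum-𝟙-unique id (deg G) (unique-vertices simple) w∈V)
                                                              (sum-𝟙-unique id (λ u → deg G u ^ 2) (unique-vertices simple) v∈V))) ⟩
      evenPart + (2 * sum (map atW (V G)) + sum (map atV (V G)))
        ≡⟨ sym (sum-map-linear 2 _ atW atV (V G)) ⟩
      sum (map (λ u → 𝟙 (not (u ≡ᵇ v)) * deg R (2 * u) ^ 2 + (2 * atW u + atV u)) (V G))
        ≡⟨ cong sum (map-cong vertex (V G)) ⟩
      sum (map (λ u → deg G u ^ 2 + 𝟙 (u ≡ᵇ w)) (V G))
        ≡⟨ sum-map-+ (λ u → deg G u ^ 2) _ (V G) ⟩
      M1 2 G + sum (map (λ u → 𝟙 (u ≡ᵇ w)) (V G))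
        ≡⟨ cong (M1 2 G +_) (sum-𝟙-unique₁ id (unique-vertices simple) w∈V) ⟩
      M1 2 G + 1 ∎
      where
      atW atV : ℕ → ℕ
      atW u = 𝟙 (u ≡ᵇ w) * deg G u
      atV u = 𝟙 (u ≡ᵇ v) * deg G u ^ 2
      vertex : ∀ u → 𝟙 (not (u ≡ᵇ v)) * deg R (2 * u) ^ 2 + (2 * atW u + atV u) ≡ deg G u ^ 2 + 𝟙 (u ≡ᵇ w)
      vertex u with u ≡ᵇ v | proof (u ≟ v)
      ... | true  | ofʸ refl rewrite ≡ᵇ-false v≢w = refl
      ... | false | ofⁿ u≢v rewrite sym (deg-R-even u≢v) =
        trans (cong₂ _+_ (+-identityʳ (D ^ 2)) (+-identityʳ (2 * (𝟙 (u ≡ᵇ w) * (D + 𝟙 (u ≡ᵇ w))))))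
              (𝟙-square-shift D (u ≡ᵇ w))
        where D = deg R (2 * u)

    oddPart-value : oddPart + (3 * deg G v + 4) ≡ 4 * m + 3
    oddPart-value = begin
      oddPart + (3 * deg G v + 4)
        ≡⟨ cong (oddPart +_) (cong₂ (λ x y → 3 * x + 4 * y) (deg-indexed v)
                                    (sym (sum-𝟙-unique₁ proj₁ unique-keys ke∈))) ⟩
      oddPart + (3 * sum (map atV indexedEdges) + 4 * sum (map isK indexedEdges))
        ≡⟨ cong (λ s → oddPart + (3 * sum (map atV indexedEdges) + s)) (sym (sum-map-*ˡ 4 isK indexedEdges)) ⟩
      oddPart + (3 * sum (map atV indexedEdges) + sum (map (λ t → 4 * isK t) indexedEdges))
        ≡⟨ sym (sum-map-linear 3 _ atV (λ t → 4 * isK t) indexedEdges) ⟩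
      sum (map (λ t → 𝟙 (not (proj₁ t ≡ᵇ k)) * deg R (suc (2 * proj₁ t)) ^ 2 + (3 * atV t + 4 * isK t)) indexedEdges)
        ≡⟨ cong sum (map-cong-local (All.tabulate subdivisionVertex)) ⟩
      sum (map (λ t → 4 + 3 * (isK t * atV t)) indexedEdges)
        ≡⟨ sum-map-+ (λ _ → 4) _ indexedEdges ⟩
      sum (map (λ _ → 4) indexedEdges) + sum (map (λ t → 3 * (isK t * atV t)) indexedEdges)
        ≡⟨ cong₂ _+_ (trans (sum-map-const 4 indexedEdges) (cong (4 *_) length-indexedEdges))
                     (trans (sum-map-*ˡ 3 _ indexedEdges)
                            (cong (3 *_) (trans (sum-𝟙-unique proj₁ atV unique-keys ke∈) (cong 𝟙 e-touches-v)))) ⟩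
      4 * m + 3 ∎
      where
      atV isK : ℕ × (ℕ × ℕ) → ℕ
      atV t = 𝟙 (touches (proj₂ t) v)
      isK t = 𝟙 (proj₁ t ≡ᵇ k)
      subdivisionVertex : ∀ {t} → t ∈ indexedEdges →
        𝟙 (not (proj₁ t ≡ᵇ k)) * deg R (suc (2 * proj₁ t)) ^ 2 + (3 * atV t + 4 * isK t) ≡ 4 + 3 * (isK t * atV t)
      subdivisionVertex {j , e′} je′∈ with j ≡ᵇ k | proof (j ≟ k)
      ... | true  | _ with touches e′ v
      ...   | true  = refl
      ...   | false = refl
      subdivisionVertex {j , e′} je′∈ | false | ofⁿ j≢k with touches e′ v | deg-R-odd je′∈ j≢k
      ...   | true  | D+1≡2 rewrite +-cancelʳ-≡ 1 (deg R (suc (2 * j))) 1 D+1≡2 = refl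
      ...   | false | D+0≡2 rewrite trans (sym (+-identityʳ (deg R (suc (2 * j))))) D+0≡2 = refl

open import Data.Nat as ℕ using (ℕ)
import Data.Nat.Properties as ℕₚ
open import Data.Integer using (ℤ; +_; _+_; _-_; _*_; -_; _^_)
open import Data.Integer.Properties using (pos-+; pos-*)
open import Data.Integer.Tactic.RingSolver using (solve-∀)
open import Data.List using (foldr)
open Counting using (sum-map-const)
open GraphCounting using (handshake)

sumℤ : List ℤ → ℤ
sumℤ = foldr _+_ (+ 0)

dot : List ℤ → List ℤ → ℤ
dot cs xs = sumℤ (zipWith _*_ cs xs)

pos-^ : ∀ n k → + (n ℕ.^ k) ≡ (+ n) ^ k
pos-^ n ℕ.zero    = refl
pos-^ n (ℕ.suc k) = trans (pos-* n (n ℕ.^ k)) (cong (+ n *_) (pos-^ n k))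

m+n≡o⇒m≡o-n : ∀ {a b c} → a ℕ.+ b ≡ c → + a ≡ + c - + b
m+n≡o⇒m≡o-n {a} {b} {c} a+b≡c = trans (add-sub (+ a) (+ b)) (cong (_- + b) (trans (sym (pos-+ a b)) (cong +_ a+b≡c)))
  where add-sub : ∀ x y → x ≡ x + y - y
        add-sub = solve-∀

module _ {A : Set} where

  pos-sum-map : (f : A → ℕ) (xs : List A) → + sum (map f xs) ≡ sumℤ (map (λ x → + f x) xs)
  pos-sum-map f []       = refl
  pos-sum-map f (x ∷ xs) = trans (pos-+ (f x) _) (cong (λ s → + f x + s) (pos-sum-map f xs))

  sumℤ-map-zero : (xs : List A) → sumℤ (map (λ _ → + 0) xs) ≡ + 0
  sumℤ-map-zero xs = trans (sym (pos-sum-map (λ _ → 0) xs)) (cong +_ (sum-map-const 0 xs))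

  sumℤ-map-linear : (c : ℤ) (f g : A → ℤ) (xs : List A) →
                    sumℤ (map (λ x → c * f x + g x) xs) ≡ c * sumℤ (map f xs) + sumℤ (map g xs)
  sumℤ-map-linear c f g []       = zero-linear c
    where zero-linear : ∀ c → + 0 ≡ c * + 0 + + 0
          zero-linear = solve-∀
  sumℤ-map-linear c f g (x ∷ xs) =
    trans (cong (λ s → c * f x + g x + s) (sumℤ-map-linear c f g xs)) (regroup c (f x) (g x) _ _)
    where regroup : ∀ c a b s t → c * a + b + (c * s + t) ≡ c * (a + s) + (b + t)
          regroup = solve-∀

  sumℤ-dot : (cs : List ℤ) (bs : List (A → ℤ)) (xs : List A) →
             sumℤ (map (λ x → dot cs (map (λ b → b x) bs)) xs) ≡ dot cs (map (λ b → sumℤ (map b xs)) bs)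
  sumℤ-dot []       bs       xs = sumℤ-map-zero xs
  sumℤ-dot (c ∷ cs) []       xs = sumℤ-map-zero xs
  sumℤ-dot (c ∷ cs) (b ∷ bs) xs =
    trans (sumℤ-map-linear c b (λ x → dot cs (map (λ b → b x) bs)) xs)
          (cong (λ s → c * sumℤ (map b xs) + s) (sumℤ-dot cs bs xs))

-- m³M₁² of S(G) - {2v, 2k+1}, with X = d(v), Y = d(w), m = m(G), A = M₁²(G).
halfEdgeValue : (m A X Y : ℤ) → ℤ
halfEdgeValue m A X Y = (+ 2 * m - X - + 1) ^ 3 * (A + + 4 * m - X ^ 2 - + 3 * X - + 2 * Y)

powerSum : ℕ → ℤ → ℤ → ℤ
powerSum k X Y = X ^ k + Y ^ k

mixedSum : ℕ → ℕ → ℤ → ℤ → ℤ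
mixedSum l x X Y = X ^ l * Y ^ x + X ^ x * Y ^ l

symmetricBasis : List (ℤ → ℤ → ℤ)
symmetricBasis =
  (λ _ _ → + 1) ∷ powerSum 1 ∷ powerSum 2 ∷ powerSum 3 ∷ powerSum 4 ∷ powerSum 5
  ∷ _*_ ∷ mixedSum 1 2 ∷ mixedSum 1 3 ∷ []

coefficients : ℤ → ℤ → List ℤ
coefficients m A =
    (+ 64 * m * m * m * m + + 16 * m * m * m * A - + 96 * m * m * m - + 24 * m * m * A + + 48 * m * m + + 12 * m * A - + 8 * m - + 2 * A)
  ∷ (- (+ 88) * m * m * m - + 12 * m * m * A + + 108 * m * m + + 12 * m * A - + 42 * m - + 3 * A + + 5)
  ∷ (- (+ 8) * m * m * m + + 72 * m * m + + 6 * m * A - + 54 * m - + 3 * A + + 10)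
  ∷ (+ 12 * m * m - + 34 * m - A + + 12)
  ∷ (- (+ 6) * m + + 6)
  ∷ (+ 1)
  ∷ (+ 48 * m * m - + 48 * m + + 12)
  ∷ (- (+ 12) * m + + 6)
  ∷ (+ 2)
  ∷ []

halfEdgeValue-symmetrized : ∀ m A X Y →
  halfEdgeValue m A X Y + halfEdgeValue m A Y X ≡ dot (coefficients m A) (map (λ b → b X Y) symmetricBasis)
halfEdgeValue-symmetrized = expansion
  where
  -- The ring solver does not unfold definitions, so the identity is stated on the unfolded terms.
  expansion : ∀ m A X Y →
    (+ 2 * m - X - + 1) * ((+ 2 * m - X - + 1) * ((+ 2 * m - X - + 1) * + 1)) * (A + + 4 * m - X * (X * + 1) - + 3 * X - + 2 * Y)
    + (+ 2 * m - Y - + 1) * ((+ 2 * m - Y - + 1) * ((+ 2 * m - Y - + 1) * + 1)) * (A + + 4 * m - Y * (Y * + 1) - + 3 * Y - + 2 * X)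
    ≡ (+ 64 * m * m * m * m + + 16 * m * m * m * A - + 96 * m * m * m - + 24 * m * m * A + + 48 * m * m + + 12 * m * A - + 8 * m - + 2 * A) * (+ 1)
      + ((- (+ 88) * m * m * m - + 12 * m * m * A + + 108 * m * m + + 12 * m * A - + 42 * m - + 3 * A + + 5) * (X * + 1 + Y * + 1)
      + ((- (+ 8) * m * m * m + + 72 * m * m + + 6 * m * A - + 54 * m - + 3 * A + + 10) * (X * (X * + 1) + Y * (Y * + 1))
      + ((+ 12 * m * m - + 34 * m - A + + 12) * (X * (X * (X * + 1)) + Y * (Y * (Y * + 1)))
      + ((- (+ 6) * m + + 6) * (X * (X * (X * (X * + 1))) + Y * (Y * (Y * (Y * + 1))))
      + ((+ 1) * (X * (X * (X * (X * (X * + 1)))) + Y * (Y * (Y * (Y * (Y * + 1)))))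
      + ((+ 48 * m * m - + 48 * m + + 12) * (X * Y)
      + ((- (+ 12) * m + + 6) * ((X * + 1) * (Y * (Y * + 1)) + (X * (X * + 1)) * (Y * + 1))
      + ((+ 2) * ((X * + 1) * (Y * (Y * (Y * + 1))) + (X * (X * (X * + 1))) * (Y * + 1))
      + + 0))))))))
  expansion = solve-∀

module InvariantSums (G : Graph) (simple : IsSimpleGraph G) where

  open ≡-Reasoning

  dz : ℕ → ℤ
  dz u = + deg G u

  atEdge : (ℤ → ℤ → ℤ) → ℕ × ℕ → ℤ
  atEdge b e = b (dz (proj₁ e)) (dz (proj₂ e))

  invariants : List ℤ
  invariants = + edgeCount G ∷ + M1 2 G ∷ + M1 3 G ∷ + M1 4 G ∷ + M1 5 G ∷ + M1 6 G
             ∷ + M2 G ∷ + alphaInv 1 2 G ∷ + alphaInv 1 3 G ∷ []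

  pos-monomial : ∀ a l b x → + (a ℕ.^ l ℕ.* b ℕ.^ x) ≡ (+ a) ^ l * (+ b) ^ x
  pos-monomial a l b x = trans (pos-* (a ℕ.^ l) (b ℕ.^ x)) (cong₂ _*_ (pos-^ a l) (pos-^ b x))

  sum-one : sumℤ (map (atEdge (λ _ _ → + 1)) (E G)) ≡ + edgeCount G
  sum-one = trans (sym (pos-sum-map (λ _ → 1) (E G))) (cong +_ (trans (sum-map-const 1 (E G)) (ℕₚ.*-identityˡ _)))

  sum-powerSum : ∀ k → sumℤ (map (atEdge (powerSum k)) (E G)) ≡ + M1 (ℕ.suc k) G
  sum-powerSum k = begin
    sumℤ (map (atEdge (powerSum k)) (E G))
      ≡⟨ cong sumℤ (map-cong (λ e → sym (trans (pos-+ (deg G (proj₁ e) ℕ.^ k) _)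
                                                (cong₂ _+_ (pos-^ _ k) (pos-^ _ k)))) (E G)) ⟩
    sumℤ (map (λ e → + (deg G (proj₁ e) ℕ.^ k ℕ.+ deg G (proj₂ e) ℕ.^ k)) (E G))
      ≡⟨ sym (pos-sum-map _ (E G)) ⟩
    + sum (map (λ e → deg G (proj₁ e) ℕ.^ k ℕ.+ deg G (proj₂ e) ℕ.^ k) (E G))
      ≡⟨ cong +_ (handshake G simple (λ u → deg G u ℕ.^ k)) ⟩
    + M1 (ℕ.suc k) G ∎

  sum-product : sumℤ (map (atEdge _*_) (E G)) ≡ + M2 G
  sum-product = sym (trans (pos-sum-map _ (E G)) (cong sumℤ (map-cong (λ e → pos-* (deg G (proj₁ e)) _) (E G))))

  sum-mixedSum : ∀ l x → sumℤ (map (atEdge (mixedSum l x)) (E G)) ≡ + alphaInv l x G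
  sum-mixedSum l x = sym (trans (pos-sum-map _ (E G)) (cong sumℤ (map-cong mixed (E G))))
    where
    mixed : ∀ e → + (deg G (proj₁ e) ℕ.^ l ℕ.* deg G (proj₂ e) ℕ.^ x
                     ℕ.+ deg G (proj₁ e) ℕ.^ x ℕ.* deg G (proj₂ e) ℕ.^ l)
                  ≡ atEdge (mixedSum l x) e
    mixed (a , b) = trans (pos-+ (deg G a ℕ.^ l ℕ.* deg G b ℕ.^ x) _)
                          (cong₂ _+_ (pos-monomial (deg G a) l (deg G b) x) (pos-monomial (deg G a) x (deg G b) l))

  basis-sums : map (λ b → sumℤ (map b (E G))) (map atEdge symmetricBasis) ≡ invariants
  basis-sums =
    cong₂ _∷_ sum-one (cong₂ _∷_ (sum-powerSum 1) (cong₂ _∷_ (sum-powerSum 2) (cong₂ _∷_ (sum-powerSum 3)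
      (cong₂ _∷_ (sum-powerSum 4) (cong₂ _∷_ (sum-powerSum 5) (cong₂ _∷_ sum-product
      (cong₂ _∷_ (sum-mixedSum 1 2) (cong₂ _∷_ (sum-mixedSum 1 3) refl))))))))

module SubdivisionValues (G : Graph) (simple : IsSimpleGraph G) where

  open SubdivisionCounting G simple
  open InvariantSums G simple
  open ≡-Reasoning

  module _ {k e} (ke∈ : (k , e) ∈ indexedEdges) {v w} (v≢w : v ≢ w) (v∈V : v ∈ V G) (w∈V : w ∈ V G)
           (ends : ∀ u → touches e u ≡ touches (v , w) u) where

    open HalfEdge ke∈ v≢w v∈V w∈V ends

    edgeCount-R-ℤ : + edgeCount R ≡ + 2 * + m - dz v - + 1
    edgeCount-R-ℤ = begin
      + edgeCount R
        ≡⟨ m+n≡o⇒m≡o-n {edgeCount R} edgeCount-R ⟩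
      + (2 ℕ.* m ℕ.+ 1) - + (deg G v ℕ.+ 2)
        ≡⟨ cong₂ _-_ (trans (pos-+ (2 ℕ.* m) 1) (cong (λ x → x + + 1) (pos-* 2 m))) (pos-+ (deg G v) 2) ⟩
      + 2 * + m + + 1 - (dz v + + 2)
        ≡⟨ regroup (+ m) (dz v) ⟩
      + 2 * + m - dz v - + 1 ∎
      where regroup : ∀ x d → + 2 * x + + 1 - (d + + 2) ≡ + 2 * x - d - + 1
            regroup = solve-∀

    M1-R-ℤ : + M1 2 R ≡ + M1 2 G + + 4 * + m - dz v ^ 2 - + 3 * dz v - + 2 * dz w
    M1-R-ℤ = begin
      + M1 2 R
        ≡⟨ trans (cong +_ M1-R) (pos-+ evenPart oddPart) ⟩
      + evenPart + + oddPart
        ≡⟨ cong₂ _+_ (m+n≡o⇒m≡o-n {evenPart} evenPart-value) (m+n≡o⇒m≡o-n {oddPart} oddPart-value) ⟩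
      (+ (M1 2 G ℕ.+ 1) - + (2 ℕ.* deg G w ℕ.+ deg G v ℕ.^ 2)) + (+ (4 ℕ.* m ℕ.+ 3) - + (3 ℕ.* deg G v ℕ.+ 4))
        ≡⟨ cong₂ _+_ (cong₂ _-_ (pos-+ (M1 2 G) 1)
                                (trans (pos-+ (2 ℕ.* deg G w) _) (cong₂ _+_ (pos-* 2 (deg G w)) (pos-^ (deg G v) 2))))
                     (cong₂ _-_ (trans (pos-+ (4 ℕ.* m) 3) (cong (λ x → x + + 3) (pos-* 4 m)))
                                (trans (pos-+ (3 ℕ.* deg G v) 4) (cong (λ x → x + + 4) (pos-* 3 (deg G v))))) ⟩
      (+ M1 2 G + + 1 - (+ 2 * dz w + dz v ^ 2)) + (+ 4 * + m + + 3 - (+ 3 * dz v + + 4))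
        ≡⟨ regroup (+ M1 2 G) (+ m) (dz v) (dz w) (dz v ^ 2) ⟩
      + M1 2 G + + 4 * + m - dz v ^ 2 - + 3 * dz v - + 2 * dz w ∎
      where regroup : ∀ a x d d′ s → a + + 1 - (+ 2 * d′ + s) + (+ 4 * x + + 3 - (+ 3 * d + + 4))
                                     ≡ a + + 4 * x - s - + 3 * d - + 2 * d′
            regroup = solve-∀

    m3M12-R : + m3M12 R ≡ halfEdgeValue (+ m) (+ M1 2 G) (dz v) (dz w)
    m3M12-R = begin
      + (edgeCount R ℕ.^ 3 ℕ.* M1 2 R)
        ≡⟨ trans (pos-* (edgeCount R ℕ.^ 3) (M1 2 R)) (cong (λ x → x * + M1 2 R) (pos-^ (edgeCount R) 3)) ⟩
      (+ edgeCount R) ^ 3 * + M1 2 R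
        ≡⟨ cong₂ (λ x y → x ^ 3 * y) edgeCount-R-ℤ M1-R-ℤ ⟩
      halfEdgeValue (+ m) (+ M1 2 G) (dz v) (dz w) ∎

  edgeValue : ℕ × ℕ → ℤ
  edgeValue (a , b) = halfEdgeValue (+ m) (+ M1 2 G) (dz a) (dz b) + halfEdgeValue (+ m) (+ M1 2 G) (dz b) (dz a)

  P2-m3M12-subdivision : + P2 m3M12 S ≡ sumℤ (map edgeValue (E G))
  P2-m3M12-subdivision = begin
    + sum (map g (E S))
      ≡⟨ cong +_ (sum-E-S g) ⟩
    + sum (map (λ t → g (halfEdge₁ t) ℕ.+ g (halfEdge₂ t)) indexedEdges)
      ≡⟨ pos-sum-map _ indexedEdges ⟩
    sumℤ (map (λ t → + (g (halfEdge₁ t) ℕ.+ g (halfEdge₂ t))) indexedEdges)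
      ≡⟨ cong sumℤ (map-cong-local (All.tabulate halves)) ⟩
    sumℤ (map (edgeValue ∘ proj₂) indexedEdges)
      ≡⟨ cong sumℤ (trans (map-∘ indexedEdges) (cong (map edgeValue) edges-indexedEdges)) ⟩
    sumℤ (map edgeValue (E G)) ∎
    where
    g : ℕ × ℕ → ℕ
    g e = m3M12 (deleteTwo S (proj₁ e) (proj₂ e))
    halves : ∀ {t} → t ∈ indexedEdges → + (g (halfEdge₁ t) ℕ.+ g (halfEdge₂ t)) ≡ edgeValue (proj₂ t)
    halves {k , (a , b)} t∈ with edge-properties t∈
    ... | _ , a∈V , b∈V =
      trans (pos-+ (g (halfEdge₁ (k , (a , b)))) _) (cong₂ _+_ (m3M12-R t∈ a≢b a∈V b∈V (λ _ → refl))
                                   (m3M12-R t∈ (a≢b ∘ sym) b∈V a∈V (λ u → ∨-comm (a ℕ.≡ᵇ u) (b ℕ.≡ᵇ u))))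
      where a≢b = endpoints-distinct t∈

  P2-m3M12-subdivision-invariants : + P2 m3M12 S ≡ dot (coefficients (+ m) (+ M1 2 G)) invariants
  P2-m3M12-subdivision-invariants = begin
    + P2 m3M12 S
      ≡⟨ P2-m3M12-subdivision ⟩
    sumℤ (map edgeValue (E G))
      ≡⟨ cong sumℤ (map-cong (λ e → halfEdgeValue-symmetrized (+ m) (+ M1 2 G) (dz (proj₁ e)) (dz (proj₂ e)))
                             (E G)) ⟩
    sumℤ (map (λ e → dot cs (map (λ b → b e) (map atEdge symmetricBasis))) (E G))
      ≡⟨ sumℤ-dot cs (map atEdge symmetricBasis) (E G) ⟩
    dot cs (map (λ b → sumℤ (map b (E G))) (map atEdge symmetricBasis))
      ≡⟨ cong (dot cs) basis-sums ⟩
    dot cs invariants ∎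
    where cs = coefficients (+ m) (+ M1 2 G)

collect-invariants : ∀ m A B C D F Q a12 a13 →
  dot (coefficients m A) (m ∷ A ∷ B ∷ C ∷ D ∷ F ∷ Q ∷ a12 ∷ a13 ∷ [])
  ≡ + 64 * m * m * m * m * m
    + (+ 16 * A - + 96) * m * m * m * m
    + (- (+ 8) * B - + 112 * A + + 48) * m * m * m
    + (- (+ 12) * A * A + + 72 * B + + 120 * A + + 12 * C + + 48 * Q - + 8) * m * m
    + (+ 12 * A * A + (+ 6 * B - + 44) * A - + 54 * B - + 48 * Q - + 34 * C - + 6 * D - + 12 * a12) * m
    - + 3 * A * A + (- (+ 3) * B - C + + 5) * A + + 10 * B + + 12 * Q + + 12 * C + + 6 * D + F
    + + 6 * a12 + + 2 * a13
collect-invariants = collect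
  where
  collect : ∀ m A B C D F Q a12 a13 →
    (+ 64 * m * m * m * m + + 16 * m * m * m * A - + 96 * m * m * m - + 24 * m * m * A + + 48 * m * m + + 12 * m * A - + 8 * m - + 2 * A) * m
    + ((- (+ 88) * m * m * m - + 12 * m * m * A + + 108 * m * m + + 12 * m * A - + 42 * m - + 3 * A + + 5) * A
    + ((- (+ 8) * m * m * m + + 72 * m * m + + 6 * m * A - + 54 * m - + 3 * A + + 10) * B
    + ((+ 12 * m * m - + 34 * m - A + + 12) * C
    + ((- (+ 6) * m + + 6) * D
    + ((+ 1) * F
    + ((+ 48 * m * m - + 48 * m + + 12) * Q
    + ((- (+ 12) * m + + 6) * a12
    + ((+ 2) * a13
    + + 0))))))))
    ≡ + 64 * m * m * m * m * m
      + (+ 16 * A - + 96) * m * m * m * m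
      + (- (+ 8) * B - + 112 * A + + 48) * m * m * m
      + (- (+ 12) * A * A + + 72 * B + + 120 * A + + 12 * C + + 48 * Q - + 8) * m * m
      + (+ 12 * A * A + (+ 6 * B - + 44) * A - + 54 * B - + 48 * Q - + 34 * C - + 6 * D - + 12 * a12) * m
      - + 3 * A * A + (- (+ 3) * B - C + + 5) * A + + 10 * B + + 12 * Q + + 12 * C + + 6 * D + F
      + + 6 * a12 + + 2 * a13
  collect = solve-∀

lemma2p5 : (G : Graph) → IsSimpleGraph G →
  let m = + edgeCount G
      A = + M1 2 G
      B = + M1 3 G
      C = + M1 4 G
      D = + M1 5 G
      F = + M1 6 G
      Q = + M2 G
      a12 = + alphaInv 1 2 G
      a13 = + alphaInv 1 3 G
  in + P2 m3M12 (subdivision G)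
     ≡ + 64 * m * m * m * m * m
       + (+ 16 * A - + 96) * m * m * m * m
       + (- (+ 8) * B - + 112 * A + + 48) * m * m * m
       + (- (+ 12) * A * A + + 72 * B + + 120 * A + + 12 * C + + 48 * Q - + 8) * m * m
       + (+ 12 * A * A + (+ 6 * B - + 44) * A - + 54 * B - + 48 * Q - + 34 * C - + 6 * D - + 12 * a12) * m
       - + 3 * A * A + (- (+ 3) * B - C + + 5) * A + + 10 * B + + 12 * Q + + 12 * C + + 6 * D + F
       + + 6 * a12 + + 2 * a13
lemma2p5 G simple =
  trans (SubdivisionValues.P2-m3M12-subdivision-invariants G simple)
        (collect-invariants (+ edgeCount G) (+ M1 2 G) (+ M1 3 G) (+ M1 4 G) (+ M1 5 G) (+ M1 6 G)
                            (+ M2 G) (+ alphaInv 1 2 G) (+ alphaInv 1 3 G))
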